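{- For any integers $g \ge 0$ and $n \ge 2$ such that $g \ge \beta(K_n)=\frac12 (n-1)(n-2)$, there exists a spinal quadrangulation of $\Sigma_g$ whose chromatic number is $n$.
   Context: All graphs are finite, undirected and simple. $\Sigma_g$ denotes the closed orientable surface of genus $g$ (the sphere with $g$ handles). If a graph $G$ is 2-cell embedded in $\Sigma_g$, the components of $\Sigma_g - G$ are called regions. A quadrangulation of $\Sigma_g$ with graph $G$ is a 2-cell embedding $G \hookrightarrow \Sigma_g$ in which each region is bounded by a simple circuit of length 4 in $G$. The chromatic number of a quadrangulation is the chromatic number of its graph. For a connected graph $G$, the first Betti number is $\beta(G)=|E(G)|-|V(G)|+1$; $K_n$ is the complete graph on $n$ vertices. The 2-fold interlacement $G[:]$ of $G$ is the graph whose vertex set is the disjoint union $V(G')\sqcup V(G'')$ of two disjoint copies $G', G''$ of $G$, and whose edge set consists of $E(G')\sqcup E(G'')$ together with, for each vertex $v'\in V(G')$ (copy of $v \in V(G)$), the edges joining $v'$ to each vertex $u''\in V(G'')$ such that $u$ is adjacent to $v$ in $G$. A spinal quadrangulation (with spine $G$) is any quadrangulation $G[:] \hookrightarrow \Sigma_{\beta(G)}$, where $G$ is a non-trivial connected graph; its genus is $\beta(G)$. -}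

module Defs where

open import Data.Nat using (ℕ; zero; suc; _+_; _*_; _<_; _<ᵇ_)
open import Data.Nat.ListAction using (sum)
open import Data.Bool using (Bool; true; false; T; if_then_else_; _∧_)
open import Data.Fin using (Fin; toℕ; splitAt)
open import Data.List using (List; map; allFin)
open import Data.Product using (Σ; ∃; _×_; _,_; proj₁; proj₂)
open import Data.Sum using ([_,_])
open import Function using (id)
open import Relation.Binary.PropositionalEquality using (_≡_; _≢_; subst; refl; cong)
open import Relation.Nullary using (¬_)

record Graph : Set where
  field
    ∣V∣    : ℕ
    adj    : Fin ∣V∣ → Fin ∣V∣ → Bool
    sym    : ∀ u v → adj u v ≡ adj v u
    irrefl : ∀ v → adj v v ≡ false
open Graph public

numEdges : Graph → ℕ
numEdges G = sum (map (λ u → sum (map (λ v →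
  if adj G u v ∧ (toℕ u <ᵇ toℕ v) then 1 else 0) (allFin (∣V∣ G)))) (allFin (∣V∣ G)))

data Walk (G : Graph) : Fin (∣V∣ G) → Fin (∣V∣ G) → Set where
  here : ∀ {u} → Walk G u u
  step : ∀ {u w v} → T (adj G u w) → Walk G w v → Walk G u v

Connected : Graph → Set
Connected G = ∀ u v → Walk G u v

-- first Betti number β(G) = |E| - |V| + 1, stated as |E| + 1 ≡ |V| + b
-- (for connected G, |E| ≥ |V| - 1 so β(G) is a natural number)
HasBetti : Graph → ℕ → Set
HasBetti G b = numEdges G + 1 ≡ ∣V∣ G + b

Colourable : Graph → ℕ → Set
Colourable G k = Σ (Fin (∣V∣ G) → Fin k) λ c → ∀ u v → T (adj G u v) → c u ≢ c v

HasChromaticNumber : Graph → ℕ → Set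
HasChromaticNumber G k = Colourable G k × (∀ j → j < k → ¬ Colourable G j)

-- 2-fold interlacement G[:] : vertex set Fin (n + n) = copy G' (first n) ⊔ copy G'' (last n).
-- x ~ y iff their underlying vertices of G are adjacent in G (within G', within G'',
-- and v' ~ u'' iff u ~ v in G).
proj : ∀ n → Fin (n + n) → Fin n
proj n x = [ id , id ] (splitAt n x)

interlace : Graph → Graph
interlace G = record
  { ∣V∣    = ∣V∣ G + ∣V∣ G
  ; adj    = λ x y → adj G (proj (∣V∣ G) x) (proj (∣V∣ G) y)
  ; sym    = λ x y → sym G (proj (∣V∣ G) x) (proj (∣V∣ G) y)
  ; irrefl = λ x → irrefl G (proj (∣V∣ G) x)
  }

iterate : {A : Set} → (A → A) → ℕ → A → A
iterate f zero    a = a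
iterate f (suc k) a = f (iterate f k a)

Dart : Graph → Set
Dart H = Σ (Fin (∣V∣ H) × Fin (∣V∣ H)) λ p → T (adj H (proj₁ p) (proj₂ p))

tail : {H : Graph} → Dart H → Fin (∣V∣ H)
tail ((u , _) , _) = u

Nbr : (H : Graph) → Fin (∣V∣ H) → Set
Nbr H v = Σ (Fin (∣V∣ H)) λ u → T (adj H v u)

record RotationSystem (H : Graph) : Set where
  field
    rot      : (v : Fin (∣V∣ H)) → Nbr H v → Nbr H v
    rot-inj  : ∀ v a b → rot v a ≡ rot v b → a ≡ b
    rot-cyc  : ∀ v (a b : Nbr H v) → ∃ λ k → iterate (rot v) k a ≡ b

  φ : Dart H → Dart H
  φ ((u , v) , p) =
    let q : T (adj H v u)
        q = subst T (sym H u v) p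
        w = rot v (u , q)
    in ((v , proj₁ w) , proj₂ w)

-- A 2-cell embedding of the connected graph H in Σ_g, given combinatorially by a
-- rotation system (Heffter–Edmonds); its regions are the φ-orbits on darts, and
-- Euler's formula |V| - |E| + F = 2 - 2g (rearranged in ℕ) determines the genus g.
record Embedding (H : Graph) (g : ℕ) : Set where
  field
    connected : Connected H
    rotation  : RotationSystem H
    numFaces  : ℕ
    face      : Dart H → Fin numFaces
    face-surj : ∀ f → ∃ λ d → face d ≡ f
    face-sound : ∀ d d' → face d ≡ face d' → ∃ λ k → iterate (RotationSystem.φ rotation) k d ≡ d'
    face-complete : ∀ d k → face (iterate (RotationSystem.φ rotation) k d) ≡ face d
    euler     : ∣V∣ H + numFaces + 2 * g ≡ 2 + numEdges H

-- Quadrangulation: every region is bounded by a simple circuit of length 4,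
-- i.e. each facial walk closes after 4 steps and visits 4 distinct vertices.
IsQuadrangulation : {H : Graph} {g : ℕ} → Embedding H g → Set
IsQuadrangulation {H} e = ∀ (d : Dart H) →
    (iterate φ 4 d ≡ d)
  × (tail {H} d ≢ tail {H} (φ d)) × (tail {H} d ≢ tail {H} (iterate φ 2 d))
  × (tail {H} d ≢ tail {H} (iterate φ 3 d)) × (tail {H} (φ d) ≢ tail {H} (iterate φ 2 d))
  × (tail {H} (φ d) ≢ tail {H} (iterate φ 3 d)) × (tail {H} (iterate φ 2 d) ≢ tail {H} (iterate φ 3 d))
  where φ = RotationSystem.φ (Embedding.rotation e)

SpinalQuadrangulationWithχ : (g k : ℕ) → Set
SpinalQuadrangulationWithχ g k =
  Σ Graph λ G → (2 Data.Nat.≤ ∣V∣ G) × Connected G × HasBetti G g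
    × (Σ (Embedding (interlace G) g) IsQuadrangulation)
    × HasChromaticNumber (interlace G) k

-- The spine is K_n with a path K₀ — p — q hung at one vertex, followed by g − β(K_n)
-- twins of the degree-2 vertex p: each twin raises β by one, and both K_n ⊆ G and
-- "colour a twin like p" keep χ = n.  For G[:], fix a cyclic order σ_v of the neighbours of
-- each vertex v and rotate around v′ as X′, X″, (σ_v X)′, (σ_v X)″, … and around v″ in the
-- opposite sense.  Every face is then a quadrangle X′ Y′ X″ (σ_X⁻¹ Y)″, one per dart (X, Y) of G, so
-- F = 2|E(G)| = |E(G[:])| / 2 and Euler's formula gives genus β(G).  Colouring G[:] through
-- the projection to G, and restricting colourings to G′, shows χ(G[:]) = χ(G).

module Submission where

open import Defs renaming (sym to adj-sym)
open import Data.Nat using (ℕ; zero; suc; _+_; _*_; _∸_; _≤_; _<_; _%_; _<ᵇ_; z≤n; s≤s)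
open import Data.Nat.Properties
  using (+-suc; +-comm; +-assoc; +-identityʳ; m+[n∸m]≡n; <⇒≤; *-distribˡ-+; *-cancelˡ-≡; *-cancelˡ-≤;
         m∸n+n≡m; m≤n⇒m≤1+n; +-0-commutativeMonoid)
open import Data.Nat.DivMod using (m%n<n; %-distribˡ-+; m%n%n≡m%n; m<n⇒m%n≡m; [m+n]%n≡m%n)
open import Data.Nat.Solver using (module +-*-Solver)
import Data.Nat.ListAction as List
open import Data.Bool using (Bool; true; false; T; not; if_then_else_; _∧_)
open import Data.Bool.Properties using (T?; T-irrelevant; ∧-identityʳ; ∧-zeroʳ)
open import Data.Empty using (⊥-elim)
open import Data.Unit using (tt)
open import Data.Fin as Fin using (Fin; toℕ; fromℕ<; _↑ˡ_; _↑ʳ_; splitAt)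
open import Data.Fin.Patterns using (0F; 1F; 2F; 3F)
open import Data.Fin.Properties
  using (toℕ-injective; toℕ-fromℕ<; toℕ<n; splitAt-↑ˡ; splitAt-↑ʳ; splitAt⁻¹-↑ˡ; splitAt⁻¹-↑ʳ;
         +↔⊎; 0↔⊥; 1↔⊤; pigeonhole; <⇒≢)
open import Data.List using (map; allFin; tabulate)
open import Data.List.Properties using (map-cong)
open import Data.Product using (Σ; ∃; _×_; _,_; proj₁; proj₂)
open import Data.Product.Function.Dependent.Propositional using () renaming (congˡ to Σ-congˡ)
open import Data.Sum using (_⊎_; inj₁; inj₂; [_,_]′)
open import Data.Sum.Function.Propositional using (_⊎-↔_)
open import Data.Vec.Functional using (_∷_)
open import Function using (id; _∘_; const)
open import Function.Bundles using (_↔_; Inverse; mk↔ₛ′)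
open import Function.Properties.Inverse using (↔-refl; ↔-sym; ↔-trans)
open import Relation.Nullary using (¬_; yes; no)
open import Relation.Binary.PropositionalEquality
  using (_≡_; _≢_; refl; sym; trans; cong; cong₂; subst; module ≡-Reasoning)
open import Algebra.Properties.CommutativeMonoid.Sum +-0-commutativeMonoid
  using (sum; sum-syntax; sum-cong-≗; sum-replicate-zero; ∑-distrib-+; ∑-comm)

private variable
  A B : Set

iterate-+ : (f : A → A) (j k : ℕ) (a : A) → iterate f (j + k) a ≡ iterate f j (iterate f k a)
iterate-+ f zero    k a = refl
iterate-+ f (suc j) k a = cong f (iterate-+ f j k a)

iterate-sucʳ : (f : A → A) (k : ℕ) (a : A) → iterate f (suc k) a ≡ iterate f k (f a)
iterate-sucʳ f zero    a = refl
iterate-sucʳ f (suc k) a = cong f (iterate-sucʳ f k a)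

iterate-preserves : (f : A → A) (P : A → Set) → (∀ {a} → P a → P (f a)) →
                    ∀ k {a} → P a → P (iterate f k a)
iterate-preserves f P pres zero    p = p
iterate-preserves f P pres (suc k) p = pres (iterate-preserves f P pres k p)

iterate-intertwine : (f : A → A) (g : B → B) (h : A → B) → (∀ a → h (f a) ≡ g (h a)) →
                     ∀ k a → h (iterate f k a) ≡ iterate g k (h a)
iterate-intertwine f g h comm zero    a = refl
iterate-intertwine f g h comm (suc k) a =
  trans (comm (iterate f k a)) (cong g (iterate-intertwine f g h comm k a))

Cyclic : (A → A) → Set
Cyclic f = ∀ a b → ∃ λ k → iterate f k a ≡ b

CyclicOn : (A → Set) → (A → A) → Set
CyclicOn P f = ∀ {a b} → P a → P b → ∃ λ k → iterate f k a ≡ b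

inverse-cyclicOn : (P : A → Set) (f g : A → A) → (∀ {a} → P a → P (f a)) →
                   (∀ {a} → P a → g (f a) ≡ a) → CyclicOn P f → CyclicOn P g
inverse-cyclicOn P f g pres gf≡id cyc {a} {b} pa pb with cyc pb pa
... | k , refl = k , undo k pb
  where
  undo : ∀ k {b} → P b → iterate g k (iterate f k b) ≡ b
  undo zero    pb = refl
  undo (suc k) pb = trans (iterate-sucʳ g k _)
    (trans (cong (iterate g k) (gf≡id (iterate-preserves f P pres k pb))) (undo k pb))

shift : ∀ {d} → Fin d → Fin d
shift {suc n} i = fromℕ< (m%n<n (suc (toℕ i)) (suc n))

unshift : ∀ {d} → Fin d → Fin d
unshift {suc n} = iterate shift n

toℕ-iterate-shift : ∀ {n} (i : Fin (suc n)) k → toℕ (iterate shift k i) ≡ (toℕ i + k) % suc n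
toℕ-iterate-shift {n} i zero = begin
  toℕ i               ≡⟨ sym (m<n⇒m%n≡m (toℕ<n i)) ⟩
  toℕ i % suc n       ≡⟨ cong (_% suc n) (sym (+-identityʳ (toℕ i))) ⟩
  (toℕ i + 0) % suc n ∎
  where open ≡-Reasoning
toℕ-iterate-shift {n} i (suc k) = begin
  toℕ (shift (iterate shift k i))    ≡⟨ toℕ-fromℕ< _ ⟩
  suc (toℕ (iterate shift k i)) % d  ≡⟨ cong (λ x → suc x % d) (toℕ-iterate-shift i k) ⟩
  (1 + (toℕ i + k) % d) % d          ≡⟨ %-distribˡ-+ 1 ((toℕ i + k) % d) d ⟩
  (1 % d + (toℕ i + k) % d % d) % d  ≡⟨ cong (λ x → (1 % d + x) % d) (m%n%n≡m%n (toℕ i + k) d) ⟩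
  (1 % d + (toℕ i + k) % d) % d      ≡⟨ sym (%-distribˡ-+ 1 (toℕ i + k) d) ⟩
  suc (toℕ i + k) % d                ≡⟨ cong (_% d) (sym (+-suc (toℕ i) k)) ⟩
  (toℕ i + suc k) % d                ∎
  where
  open ≡-Reasoning
  d : ℕ
  d = suc n

iterate-shift-period : ∀ {d} (i : Fin d) → iterate shift d i ≡ i
iterate-shift-period {suc n} i = toℕ-injective (begin
  toℕ (iterate shift (suc n) i) ≡⟨ toℕ-iterate-shift i (suc n) ⟩
  (toℕ i + suc n) % suc n       ≡⟨ [m+n]%n≡m%n (toℕ i) (suc n) ⟩
  toℕ i % suc n                 ≡⟨ m<n⇒m%n≡m (toℕ<n i) ⟩
  toℕ i                         ∎)
  where open ≡-Reasoning

shift-unshift : ∀ {d} (i : Fin d) → shift (unshift i) ≡ i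
shift-unshift {suc n} = iterate-shift-period

unshift-shift : ∀ {d} (i : Fin d) → unshift (shift i) ≡ i
unshift-shift {suc n} i = trans (sym (iterate-sucʳ shift n i)) (iterate-shift-period i)

-- From i, d - i steps reach 0 and j more steps reach j.
shift-cyclic : ∀ {d} → Cyclic (shift {d})
shift-cyclic {suc n} i j = (suc n ∸ toℕ i) + toℕ j , toℕ-injective (begin
  toℕ (iterate shift ((suc n ∸ toℕ i) + toℕ j) i) ≡⟨ toℕ-iterate-shift i _ ⟩
  (toℕ i + ((suc n ∸ toℕ i) + toℕ j)) % suc n     ≡⟨ cong (_% suc n) (sym (+-assoc (toℕ i) _ (toℕ j))) ⟩
  (toℕ i + (suc n ∸ toℕ i) + toℕ j) % suc n       ≡⟨ cong (λ x → (x + toℕ j) % suc n) (m+[n∸m]≡n (<⇒≤ (toℕ<n i))) ⟩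
  (suc n + toℕ j) % suc n                         ≡⟨ cong (_% suc n) (+-comm (suc n) (toℕ j)) ⟩
  (toℕ j + suc n) % suc n                         ≡⟨ [m+n]%n≡m%n (toℕ j) (suc n) ⟩
  toℕ j % suc n                                   ≡⟨ m<n⇒m%n≡m (toℕ<n j) ⟩
  toℕ j                                           ∎)
  where open ≡-Reasoning

⌊_⌋ : Bool → ℕ
⌊ b ⌋ = if b then 1 else 0

count : ∀ {m} → (Fin m → Bool) → ℕ
count {m} P = ∑[ i < m ] ⌊ P i ⌋

sum-map-tabulate : ∀ {m} (g : Fin m → A) (f : A → ℕ) →
                   List.sum (map f (tabulate g)) ≡ ∑[ i < m ] f (g i)
sum-map-tabulate {m = zero}  g f = refl
sum-map-tabulate {m = suc m} g f = cong (f (g Fin.zero) +_) (sum-map-tabulate (g ∘ Fin.suc) f)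

sum-↑ : ∀ m {n} (f : Fin (m + n) → ℕ) → sum f ≡ sum (f ∘ (_↑ˡ n)) + sum (f ∘ (m ↑ʳ_))
sum-↑ zero    f = refl
sum-↑ (suc m) f = trans (cong (f Fin.zero +_) (sum-↑ m (f ∘ Fin.suc)))
                        (sym (+-assoc (f Fin.zero) _ _))

Σ-Fin-suc↔ : ∀ {m} {Q : Fin (suc m) → Set} → Σ (Fin (suc m)) Q ↔ (Q Fin.zero ⊎ Σ (Fin m) (Q ∘ Fin.suc))
Σ-Fin-suc↔ {m} {Q} = mk↔ₛ′ to from (λ { (inj₁ q) → refl ; (inj₂ _) → refl })
                                   (λ { (Fin.zero , q) → refl ; (Fin.suc i , q) → refl })
  where
  to : Σ (Fin (suc m)) Q → Q Fin.zero ⊎ Σ (Fin m) (Q ∘ Fin.suc)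
  to (Fin.zero  , q) = inj₁ q
  to (Fin.suc i , q) = inj₂ (i , q)
  from : Q Fin.zero ⊎ Σ (Fin m) (Q ∘ Fin.suc) → Σ (Fin (suc m)) Q
  from (inj₁ q)       = Fin.zero , q
  from (inj₂ (i , q)) = Fin.suc i , q

T↔Fin : ∀ b → T b ↔ Fin ⌊ b ⌋
T↔Fin false = ↔-sym 0↔⊥
T↔Fin true  = ↔-sym 1↔⊤

subset↔ : ∀ {m} (P : Fin m → Bool) → Σ (Fin m) (T ∘ P) ↔ Fin (count P)
subset↔ {zero}  P = mk↔ₛ′ (λ { (() , _) }) (λ ()) (λ ()) (λ { (() , _) })
subset↔ {suc m} P =
  ↔-trans Σ-Fin-suc↔ (↔-trans (T↔Fin (P Fin.zero) ⊎-↔ subset↔ (P ∘ Fin.suc)) (↔-sym +↔⊎))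

Σ-Fin↔ : ∀ {m} (f : Fin m → ℕ) → Σ (Fin m) (Fin ∘ f) ↔ Fin (sum f)
Σ-Fin↔ {zero}  f = mk↔ₛ′ (λ { (() , _) }) (λ ()) (λ ()) (λ { (() , _) })
Σ-Fin↔ {suc m} f =
  ↔-trans Σ-Fin-suc↔ (↔-trans (↔-refl ⊎-↔ Σ-Fin↔ (f ∘ Fin.suc)) (↔-sym +↔⊎))

module _ (e : A ↔ B) where
  open Inverse e

  conjugate : (B → B) → A → A
  conjugate f = from ∘ f ∘ to

  conjugate-inverse : (f g : B → B) → (∀ b → g (f b) ≡ b) → ∀ a → conjugate g (conjugate f a) ≡ a
  conjugate-inverse f g gf≡id a = begin
    from (g (to (from (f (to a))))) ≡⟨ cong (from ∘ g) (strictlyInverseˡ (f (to a))) ⟩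
    from (g (f (to a)))             ≡⟨ cong from (gf≡id (to a)) ⟩
    from (to a)                     ≡⟨ strictlyInverseʳ a ⟩
    a                               ∎
    where open ≡-Reasoning

  conjugate-cyclic : (f : B → B) → Cyclic f → Cyclic (conjugate f)
  conjugate-cyclic f cyc a b with cyc (to a) (to b)
  ... | k , fᵏ[a]≡b = k , (begin
    iterate (conjugate f) k a       ≡⟨ sym (strictlyInverseʳ _) ⟩
    from (to (iterate (conjugate f) k a)) ≡⟨ cong from (iterate-intertwine (conjugate f) f to
                                                          (λ x → strictlyInverseˡ (f (to x))) k a) ⟩
    from (iterate f k (to a))       ≡⟨ cong from fᵏ[a]≡b ⟩
    from (to b)                     ≡⟨ strictlyInverseʳ b ⟩
    b                               ∎)
    where open ≡-Reasoning

subset-≡ : ∀ {m} {P : Fin m → Bool} {a b : Σ (Fin m) (T ∘ P)} → proj₁ a ≡ proj₁ b → a ≡ b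
subset-≡ {a = u , p} {b = .u , q} refl = cong (u ,_) (T-irrelevant p q)

module _ {m} (P : Fin m → Bool) where

  extend : (Σ (Fin m) (T ∘ P) → Σ (Fin m) (T ∘ P)) → Fin m → Fin m
  extend f u with T? (P u)
  ... | yes p = proj₁ (f (u , p))
  ... | no _  = u

  extend-≡ : ∀ f {u} (p : T (P u)) → extend f u ≡ proj₁ (f (u , p))
  extend-≡ f {u} p with T? (P u)
  ... | yes p′ = cong (λ q → proj₁ (f (u , q))) (T-irrelevant p′ p)
  ... | no ¬p  = ⊥-elim (¬p p)

  extend-preserves : ∀ f {u} → T (P u) → T (P (extend f u))
  extend-preserves f {u} p = subst (T ∘ P) (sym (extend-≡ f p)) (proj₂ (f (u , p)))

  extend-inverse : ∀ f g → (∀ a → g (f a) ≡ a) → ∀ {u} → T (P u) → extend g (extend f u) ≡ u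
  extend-inverse f g gf≡id {u} p = begin
    extend g (extend f u)                    ≡⟨ extend-≡ g (extend-preserves f p) ⟩
    proj₁ (g (extend f u , extend-preserves f p)) ≡⟨ cong (proj₁ ∘ g) (subset-≡ (extend-≡ f p)) ⟩
    proj₁ (g (f (u , p)))                    ≡⟨ cong proj₁ (gf≡id (u , p)) ⟩
    u                                        ∎
    where open ≡-Reasoning

  extend-cyclicOn : ∀ f → Cyclic f → CyclicOn (T ∘ P) (extend f)
  extend-cyclicOn f cyc {u} {w} p q with cyc (u , p) (w , q)
  ... | k , fᵏ[u]≡w = k , trans (sym (iterate-intertwine f (extend f) proj₁
                                        (λ a → sym (extend-≡ f (proj₂ a))) k (u , p)))
                                (cong proj₁ fᵏ[u]≡w)

-- A cyclic order on {u | P u}, extended to all of Fin m by the identity.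
module SubsetRotation {m} (P : Fin m → Bool) where

  next prev : Fin m → Fin m
  next = extend P (conjugate (subset↔ P) shift)
  prev = extend P (conjugate (subset↔ P) unshift)

  next-preserves : ∀ {u} → T (P u) → T (P (next u))
  next-preserves = extend-preserves P _

  prev-preserves : ∀ {u} → T (P u) → T (P (prev u))
  prev-preserves = extend-preserves P _

  prev-next : ∀ {u} → T (P u) → prev (next u) ≡ u
  prev-next = extend-inverse P _ _ (conjugate-inverse (subset↔ P) shift unshift unshift-shift)

  next-prev : ∀ {u} → T (P u) → next (prev u) ≡ u
  next-prev = extend-inverse P _ _ (conjugate-inverse (subset↔ P) unshift shift shift-unshift)

  next-cyclicOn : CyclicOn (T ∘ P) next
  next-cyclicOn = extend-cyclicOn P _ (conjugate-cyclic (subset↔ P) shift shift-cyclic)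

  prev-cyclicOn : CyclicOn (T ∘ P) prev
  prev-cyclicOn = inverse-cyclicOn (T ∘ P) next prev next-preserves prev-next next-cyclicOn

proj-↑ˡ : ∀ m (i : Fin m) → proj m (i ↑ˡ m) ≡ i
proj-↑ˡ m i rewrite splitAt-↑ˡ m i m = refl

proj-↑ʳ : ∀ m (i : Fin m) → proj m (m ↑ʳ i) ≡ i
proj-↑ʳ m i rewrite splitAt-↑ʳ m m i = refl

sum-proj : ∀ m (f : Fin m → ℕ) → ∑[ x < m + m ] f (proj m x) ≡ sum f + sum f
sum-proj m f = begin
  ∑[ x < m + m ] f (proj m x)                                     ≡⟨ sum-↑ m (f ∘ proj m) ⟩
  ∑[ i < m ] f (proj m (i ↑ˡ m)) + ∑[ i < m ] f (proj m (m ↑ʳ i)) ≡⟨ cong₂ _+_ (sum-cong-≗ (cong f ∘ proj-↑ˡ m))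
                                                                                (sum-cong-≗ (cong f ∘ proj-↑ʳ m)) ⟩
  sum f + sum f                                                   ∎
  where open ≡-Reasoning

<ᵇ-trichotomy : ∀ a b → a ≢ b → ⌊ a <ᵇ b ⌋ + ⌊ b <ᵇ a ⌋ ≡ 1
<ᵇ-trichotomy zero    zero    a≢b = ⊥-elim (a≢b refl)
<ᵇ-trichotomy zero    (suc b) a≢b = refl
<ᵇ-trichotomy (suc a) zero    a≢b = refl
<ᵇ-trichotomy (suc a) (suc b) a≢b = <ᵇ-trichotomy a b (a≢b ∘ cong suc)

bool-cases : ∀ a c → a ≡ c ⊎ a ≡ not c
bool-cases false false = inj₁ refl
bool-cases false true  = inj₂ refl
bool-cases true  false = inj₂ refl
bool-cases true  true  = inj₁ refl

-- An orbit of R that alternates between ι X c and ι X (not c), advancing X along τ,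
-- passes through every ι X a as soon as τ is cyclic.
module _ (ι : A → Bool → B) (R : B → B) (P : A → Set) (τ : A → A) (c : Bool)
  (flip : ∀ {X} → P X → R (ι X c) ≡ ι X (not c))
  (advance : ∀ {X} → P X → R (ι X (not c)) ≡ ι (τ X) c)
  (pres : ∀ {X} → P X → P (τ X)) (cyc : CyclicOn P τ) where

  private
    round : ∀ k {X} → P X → iterate R (k * 2) (ι X c) ≡ ι (iterate τ k X) c
    round zero    p = refl
    round (suc k) p = trans (cong (R ∘ R) (round k p))
      (trans (cong R (flip (iterate-preserves τ P pres k p))) (advance (iterate-preserves τ P pres k p)))

    from-c : ∀ {X X′} a′ → P X → P X′ → ∃ λ k → iterate R k (ι X c) ≡ ι X′ a′
    from-c a′ p p′ with cyc p p′ | bool-cases a′ c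
    ... | k , refl | inj₁ refl = k * 2 , round k p
    ... | k , refl | inj₂ refl = suc (k * 2) ,
      trans (cong R (round k p)) (flip (iterate-preserves τ P pres k p))

  alternating-cyclicOn : ∀ {X X′} a a′ → P X → P X′ → ∃ λ k → iterate R k (ι X a) ≡ ι X′ a′
  alternating-cyclicOn {X} a a′ p p′ with bool-cases a c
  ... | inj₁ refl = from-c a′ p p′
  ... | inj₂ refl with from-c a′ (pres p) p′
  ...   | k , e = k + 1 , trans (iterate-+ R k 1 (ι X (not c))) (trans (cong (iterate R k) (advance p)) e)

adj⇒≢ : (G : Graph) {u v : Fin (∣V∣ G)} → T (adj G u v) → u ≢ v
adj⇒≢ G {u} q refl = subst T (irrefl G u) q

degree : (G : Graph) → Fin (∣V∣ G) → ℕ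
degree G v = count (adj G v)

module _ (G : Graph) where

  private
    n : ℕ
    n = ∣V∣ G
    below : Fin n → Fin n → ℕ
    below u v = ⌊ adj G u v ∧ (toℕ u <ᵇ toℕ v) ⌋

  numEdges-∑ : numEdges G ≡ ∑[ u < n ] ∑[ v < n ] below u v
  numEdges-∑ = trans (cong List.sum (map-cong (λ u → sum-map-tabulate id (below u)) (allFin n)))
                     (sum-map-tabulate id (λ u → ∑[ v < n ] below u v))

  adj-split : ∀ u v → ⌊ adj G u v ⌋ ≡ below u v + below v u
  adj-split u v with adj G u v in eq
  ... | true  rewrite trans (adj-sym G v u) eq =
    sym (<ᵇ-trichotomy (toℕ u) (toℕ v) (adj⇒≢ G (subst T (sym eq) tt) ∘ toℕ-injective))
  ... | false rewrite trans (adj-sym G v u) eq = refl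

  handshake : ∑[ u < n ] ∑[ v < n ] ⌊ adj G u v ⌋ ≡ 2 * numEdges G
  handshake = begin
    ∑[ u < n ] ∑[ v < n ] ⌊ adj G u v ⌋                                 ≡⟨ sum-cong-≗ (λ u → sum-cong-≗ (adj-split u)) ⟩
    ∑[ u < n ] ∑[ v < n ] (below u v + below v u)                       ≡⟨ sum-cong-≗ (λ u → ∑-distrib-+ (below u) (λ v → below v u)) ⟩
    ∑[ u < n ] (∑[ v < n ] below u v + ∑[ v < n ] below v u)            ≡⟨ ∑-distrib-+ (λ u → ∑[ v < n ] below u v) (λ u → ∑[ v < n ] below v u) ⟩
    ∑[ u < n ] ∑[ v < n ] below u v + ∑[ u < n ] ∑[ v < n ] below v u   ≡⟨ cong (E +_) (∑-comm (λ u v → below v u)) ⟩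
    E + E                                                               ≡⟨ cong (E +_) (sym (+-identityʳ E)) ⟩
    2 * E                                                               ≡⟨ cong (2 *_) (sym numEdges-∑) ⟩
    2 * numEdges G                                                      ∎
    where
    open ≡-Reasoning
    E : ℕ
    E = ∑[ u < n ] ∑[ v < n ] below u v

another-vertex : ∀ {m} → 2 ≤ m → (v : Fin m) → ∃ λ w → v ≢ w
another-vertex (s≤s (s≤s z≤n)) Fin.zero    = Fin.suc Fin.zero , λ ()
another-vertex (s≤s (s≤s z≤n)) (Fin.suc v) = Fin.zero , λ ()

has-neighbour : (G : Graph) → 2 ≤ ∣V∣ G → Connected G → ∀ v → ∃ λ u → T (adj G v u)
has-neighbour G 2≤m conn v with another-vertex 2≤m v
... | w , v≢w = first-step (conn v w) v≢w
  where
  first-step : ∀ {v w} → Walk G v w → v ≢ w → ∃ λ u → T (adj G v u)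
  first-step here       v≢v = ⊥-elim (v≢v refl)
  first-step (step q _) _   = _ , q

module Spinal (G : Graph) where

  H : Graph
  H = interlace G

  m : ℕ
  m = ∣V∣ G

  -- copy v false is v′ ∈ G′ and copy v true is v″ ∈ G″.
  copy : Fin m → Bool → Fin (m + m)
  copy v false = v ↑ˡ m
  copy v true  = m ↑ʳ v

  side : Fin (m + m) → Bool
  side x = [ const false , const true ]′ (splitAt m x)

  proj-copy : ∀ v b → proj m (copy v b) ≡ v
  proj-copy v false = proj-↑ˡ m v
  proj-copy v true  = proj-↑ʳ m v

  side-copy : ∀ v b → side (copy v b) ≡ b
  side-copy v false rewrite splitAt-↑ˡ m v m = refl
  side-copy v true  rewrite splitAt-↑ʳ m m v = refl

  copy-proj-side : ∀ x → copy (proj m x) (side x) ≡ x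
  copy-proj-side x with splitAt m x in eq
  ... | inj₁ v = splitAt⁻¹-↑ˡ eq
  ... | inj₂ v = splitAt⁻¹-↑ʳ eq

  copy-injective : ∀ v b u c → copy v b ≡ copy u c → v ≡ u × b ≡ c
  copy-injective v b u c e =
    trans (sym (proj-copy v b)) (trans (cong (proj m) e) (proj-copy u c)) ,
    trans (sym (side-copy v b)) (trans (cong side e) (side-copy u c))

  copy-sides : ∀ v u → copy v false ≢ copy u true
  copy-sides v u e with proj₂ (copy-injective v false u true e)
  ... | ()

  adj-copy : ∀ v b u c → adj H (copy v b) (copy u c) ≡ adj G v u
  adj-copy v b u c rewrite proj-copy v b | proj-copy u c = refl

  σ σ⁻¹ : Fin m → Fin m → Fin m
  σ   Y = SubsetRotation.next (adj G Y)
  σ⁻¹ Y = SubsetRotation.prev (adj G Y)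

  -- The rotation at Y′ sends X′ ↦ X″ ↦ (σ Y X)′, and the one at Y″ sends X″ ↦ X′ ↦ (σ⁻¹ Y X)″:
  -- the two copies are rotated in opposite senses.
  spin : Fin m → Bool → Fin m → Bool → Fin (m + m)
  spin Y false X false = copy X true
  spin Y false X true  = copy (σ Y X) false
  spin Y true  X true  = copy X false
  spin Y true  X false = copy (σ⁻¹ Y X) true

  unspin : Fin m → Bool → Fin m → Bool → Fin (m + m)
  unspin Y false X true  = copy X false
  unspin Y false X false = copy (σ⁻¹ Y X) true
  unspin Y true  X false = copy X true
  unspin Y true  X true  = copy (σ Y X) false

  rot : Fin (m + m) → Fin (m + m) → Fin (m + m)
  rot y x = spin (proj m y) (side y) (proj m x) (side x)

  rot-copy : ∀ y X a → rot y (copy X a) ≡ spin (proj m y) (side y) X a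
  rot-copy y X a rewrite proj-copy X a | side-copy X a = refl

  spin-adj : ∀ Y b X a → T (adj G Y X) → T (adj G Y (proj m (spin Y b X a)))
  spin-adj Y false X false q rewrite proj-copy X true = q
  spin-adj Y false X true  q rewrite proj-copy (σ Y X) false = SubsetRotation.next-preserves (adj G Y) q
  spin-adj Y true  X true  q rewrite proj-copy X false = q
  spin-adj Y true  X false q rewrite proj-copy (σ⁻¹ Y X) true = SubsetRotation.prev-preserves (adj G Y) q

  unspin-spin : ∀ Y b X a → T (adj G Y X) →
                unspin Y b (proj m (spin Y b X a)) (side (spin Y b X a)) ≡ copy X a
  unspin-spin Y false X false q rewrite proj-copy X true | side-copy X true = refl
  unspin-spin Y false X true  q rewrite proj-copy (σ Y X) false | side-copy (σ Y X) false =
    cong (λ Z → copy Z true) (SubsetRotation.prev-next (adj G Y) q)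
  unspin-spin Y true  X true  q rewrite proj-copy X false | side-copy X false = refl
  unspin-spin Y true  X false q rewrite proj-copy (σ⁻¹ Y X) true | side-copy (σ⁻¹ Y X) true =
    cong (λ Z → copy Z false) (SubsetRotation.next-prev (adj G Y) q)

  ρ : (y : Fin (m + m)) → Nbr H y → Nbr H y
  ρ y (x , q) = rot y x , spin-adj (proj m y) (side y) (proj m x) (side x) q

  ρ-injective : ∀ y a b → ρ y a ≡ ρ y b → a ≡ b
  ρ-injective y (x , p) (x′ , p′) e = subset-≡ (begin
    x                                  ≡⟨ sym (copy-proj-side x) ⟩
    copy (proj m x) (side x)           ≡⟨ sym (unspin-spin Y b (proj m x) (side x) p) ⟩
    unspin Y b (proj m (rot y x)) (side (rot y x))   ≡⟨ cong (λ z → unspin Y b (proj m z) (side z)) (cong proj₁ e) ⟩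
    unspin Y b (proj m (rot y x′)) (side (rot y x′)) ≡⟨ unspin-spin Y b (proj m x′) (side x′) p′ ⟩
    copy (proj m x′) (side x′)         ≡⟨ copy-proj-side x′ ⟩
    x′                                 ∎)
    where
    open ≡-Reasoning
    Y : Fin m
    Y = proj m y
    b : Bool
    b = side y

  rot-alternates : ∀ y b → side y ≡ b → ∀ {X X′} a a′ →
    T (adj G (proj m y) X) → T (adj G (proj m y) X′) → ∃ λ k → iterate (rot y) k (copy X a) ≡ copy X′ a′
  rot-alternates y false e =
    alternating-cyclicOn copy (rot y) (T ∘ adj G Y) (σ Y) false
      (λ {X} _ → trans (rot-copy y X false) (cong (λ s → spin Y s X false) e))
      (λ {X} _ → trans (rot-copy y X true) (cong (λ s → spin Y s X true) e))
      (SubsetRotation.next-preserves (adj G Y)) (SubsetRotation.next-cyclicOn (adj G Y))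
    where
    Y : Fin m
    Y = proj m y
  rot-alternates y true e =
    alternating-cyclicOn copy (rot y) (T ∘ adj G Y) (σ⁻¹ Y) true
      (λ {X} _ → trans (rot-copy y X true) (cong (λ s → spin Y s X true) e))
      (λ {X} _ → trans (rot-copy y X false) (cong (λ s → spin Y s X false) e))
      (SubsetRotation.prev-preserves (adj G Y)) (SubsetRotation.prev-cyclicOn (adj G Y))
    where
    Y : Fin m
    Y = proj m y

  ρ-cyclic : ∀ y → Cyclic (ρ y)
  ρ-cyclic y (x , p) (x′ , p′) with rot-alternates y (side y) refl (side x) (side x′) p p′
  ... | k , e = k , subset-≡ (begin
    proj₁ (iterate (ρ y) k (x , p))        ≡⟨ iterate-intertwine (ρ y) (rot y) proj₁ (λ _ → refl) k (x , p) ⟩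
    iterate (rot y) k x                    ≡⟨ cong (iterate (rot y) k) (sym (copy-proj-side x)) ⟩
    iterate (rot y) k (copy (proj m x) (side x)) ≡⟨ e ⟩
    copy (proj m x′) (side x′)             ≡⟨ copy-proj-side x′ ⟩
    x′                                     ∎)
    where open ≡-Reasoning

  rotation : RotationSystem H
  rotation = record { rot = ρ ; rot-inj = ρ-injective ; rot-cyc = ρ-cyclic }

  φ : Dart H → Dart H
  φ = RotationSystem.φ rotation

  GDart : Set
  GDart = Σ (Fin m) (Nbr G)

  ends : GDart → Fin m × Fin m
  ends (X , Y , _) = X , Y

  gdart-≡ : {e e′ : GDart} → ends e ≡ ends e′ → e ≡ e′
  gdart-≡ {X , Y , q} {.X , .Y , q′} refl = cong (λ r → X , Y , r) (T-irrelevant q q′)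

  dart-≡ : {d d′ : Dart H} → proj₁ d ≡ proj₁ d′ → d ≡ d′
  dart-≡ {p , q} {.p , q′} refl = cong (p ,_) (T-irrelevant q q′)

  trace : Fin (m + m) × Fin (m + m) → Fin (m + m) × Fin (m + m)
  trace (x , y) = y , rot y x

  iterate-φ : ∀ k d → proj₁ (iterate φ k d) ≡ iterate trace k (proj₁ d)
  iterate-φ = iterate-intertwine φ trace proj₁ (λ _ → refl)

  rot-copies : ∀ Y b X a → rot (copy Y b) (copy X a) ≡ spin Y b X a
  rot-copies Y b X a rewrite proj-copy Y b | side-copy Y b | proj-copy X a | side-copy X a = refl

  faceDart : Fin 4 → GDart → Fin (m + m) × Fin (m + m)
  faceDart 0F (X , Y , _) = copy X false , copy Y false
  faceDart 1F (X , Y , _) = copy Y false , copy X true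
  faceDart 2F (X , Y , _) = copy X true , copy (σ⁻¹ X Y) true
  faceDart 3F (X , Y , _) = copy (σ⁻¹ X Y) true , copy X false

  trace-faceDart : ∀ t e → trace (faceDart t e) ≡ faceDart (shift t) e
  trace-faceDart 0F (X , Y , q) = cong (copy Y false ,_) (rot-copies Y false X false)
  trace-faceDart 1F (X , Y , q) = cong (copy X true ,_) (rot-copies X true Y false)
  trace-faceDart 2F (X , Y , q) = cong (copy (σ⁻¹ X Y) true ,_) (rot-copies (σ⁻¹ X Y) true X true)
  trace-faceDart 3F (X , Y , q) = cong (copy X false ,_)
    (trans (rot-copies X false (σ⁻¹ X Y) true) (cong (λ Z → copy Z false) (SubsetRotation.next-prev (adj G X) q)))

  iterate-trace : ∀ k t e → iterate trace k (faceDart t e) ≡ faceDart (iterate shift k t) e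
  iterate-trace zero    t e = refl
  iterate-trace (suc k) t e =
    trans (cong trace (iterate-trace k t e)) (trace-faceDart (iterate shift k t) e)

  position : Bool → Bool → Fin 4
  position false false = 0F
  position false true  = 1F
  position true  true  = 2F
  position true  false = 3F

  faceOf : Fin m → Bool → Fin m → Bool → Fin m × Fin m
  faceOf X false Y false = X , Y
  faceOf X false Y true  = Y , X
  faceOf X true  Y true  = X , σ X Y
  faceOf X true  Y false = Y , σ Y X

  faceOf-adj : ∀ X a Y b → T (adj G X Y) → T (adj G (proj₁ (faceOf X a Y b)) (proj₂ (faceOf X a Y b)))
  faceOf-adj X false Y false q = q
  faceOf-adj X false Y true  q = subst T (adj-sym G X Y) q
  faceOf-adj X true  Y true  q = SubsetRotation.next-preserves (adj G X) q
  faceOf-adj X true  Y false q = SubsetRotation.next-preserves (adj G Y) (subst T (adj-sym G X Y) q)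

  positionOf : Dart H → Fin 4
  positionOf ((x , y) , _) = position (side x) (side y)

  faceOfPair : Fin (m + m) × Fin (m + m) → Fin m × Fin m
  faceOfPair (x , y) = faceOf (proj m x) (side x) (proj m y) (side y)

  faceOfDart : Dart H → GDart
  faceOfDart ((x , y) , q) = proj₁ (faceOfPair (x , y)) , proj₂ (faceOfPair (x , y)) ,
                             faceOf-adj (proj m x) (side x) (proj m y) (side y) q

  faceOfPair-copies : ∀ X a Y b → faceOfPair (copy X a , copy Y b) ≡ faceOf X a Y b
  faceOfPair-copies X a Y b rewrite proj-copy X a | side-copy X a | proj-copy Y b | side-copy Y b = refl

  faceOfPair-faceDart : ∀ t e → faceOfPair (faceDart t e) ≡ ends e
  faceOfPair-faceDart 0F (X , Y , q) = faceOfPair-copies X false Y false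
  faceOfPair-faceDart 1F (X , Y , q) = faceOfPair-copies Y false X true
  faceOfPair-faceDart 2F (X , Y , q) = trans (faceOfPair-copies X true (σ⁻¹ X Y) true)
    (cong (X ,_) (SubsetRotation.next-prev (adj G X) q))
  faceOfPair-faceDart 3F (X , Y , q) = trans (faceOfPair-copies (σ⁻¹ X Y) true X false)
    (cong (X ,_) (SubsetRotation.next-prev (adj G X) q))

  copies-decomposition : ∀ X a Y b (q : T (adj G X Y)) →
    (copy X a , copy Y b) ≡ faceDart (position a b) (proj₁ (faceOf X a Y b) , proj₂ (faceOf X a Y b) , faceOf-adj X a Y b q)
  copies-decomposition X false Y false q = refl
  copies-decomposition X false Y true  q = refl
  copies-decomposition X true  Y true  q =
    cong (λ Z → copy X true , copy Z true) (sym (SubsetRotation.prev-next (adj G X) q))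
  copies-decomposition X true  Y false q =
    cong (λ Z → copy Z true , copy Y false) (sym (SubsetRotation.prev-next (adj G Y) (subst T (adj-sym G X Y) q)))

  dart-decomposition : ∀ d → proj₁ d ≡ faceDart (positionOf d) (faceOfDart d)
  dart-decomposition ((x , y) , q) =
    trans (cong₂ _,_ (sym (copy-proj-side x)) (sym (copy-proj-side y)))
          (copies-decomposition (proj m x) (side x) (proj m y) (side y) q)

  iterate-φ-faceDart : ∀ k d → proj₁ (iterate φ k d) ≡ faceDart (iterate shift k (positionOf d)) (faceOfDart d)
  iterate-φ-faceDart k d = trans (iterate-φ k d)
    (trans (cong (iterate trace k) (dart-decomposition d)) (iterate-trace k (positionOf d) (faceOfDart d)))

  faceOfDart-iterate-φ : ∀ k d → faceOfDart (iterate φ k d) ≡ faceOfDart d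
  faceOfDart-iterate-φ k d = gdart-≡ (trans (cong faceOfPair (iterate-φ-faceDart k d))
                                     (faceOfPair-faceDart (iterate shift k (positionOf d)) (faceOfDart d)))

  darts↔ : GDart ↔ Fin (sum (degree G))
  darts↔ = ↔-trans (Σ-congˡ (λ {v} → subset↔ (adj G v))) (Σ-Fin↔ (degree G))

  face : Dart H → Fin (sum (degree G))
  face = Inverse.to darts↔ ∘ faceOfDart

  face-complete : ∀ d k → face (iterate φ k d) ≡ face d
  face-complete d k = cong (Inverse.to darts↔) (faceOfDart-iterate-φ k d)

  face-sound : ∀ d d′ → face d ≡ face d′ → ∃ λ k → iterate φ k d ≡ d′
  face-sound d d′ e with shift-cyclic (positionOf d) (positionOf d′)
  ... | k , shiftᵏ≡ = k , dart-≡ (begin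
    proj₁ (iterate φ k d)                              ≡⟨ iterate-φ-faceDart k d ⟩
    faceDart (iterate shift k (positionOf d)) (faceOfDart d)      ≡⟨ cong₂ faceDart shiftᵏ≡ same-face ⟩
    faceDart (positionOf d′) (faceOfDart d′)                      ≡⟨ sym (dart-decomposition d′) ⟩
    proj₁ d′                                           ∎)
    where
    open ≡-Reasoning
    same-face : faceOfDart d ≡ faceOfDart d′
    same-face = trans (sym (Inverse.strictlyInverseʳ darts↔ (faceOfDart d)))
                     (trans (cong (Inverse.from darts↔) e) (Inverse.strictlyInverseʳ darts↔ (faceOfDart d′)))

  face-surj : ∀ f → ∃ λ d → face d ≡ f
  face-surj f = d , trans (cong (Inverse.to darts↔) (gdart-≡ (faceOfPair-faceDart 0F e)))
                          (Inverse.strictlyInverseˡ darts↔ f)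
    where
    e : GDart
    e = Inverse.from darts↔ f
    d : Dart H
    d = faceDart 0F e , subst T (sym (adj-copy (proj₁ e) false (proj₁ (proj₂ e)) false)) (proj₂ (proj₂ e))

  corner : Fin 4 → GDart → Fin (m + m)
  corner t e = proj₁ (faceDart t e)

  corners-distinct : ∀ t t′ e → corner t e ≡ corner t′ e → t ≡ t′
  corners-distinct 0F 0F e c = refl
  corners-distinct 0F 1F (X , Y , q) c = ⊥-elim (adj⇒≢ G q (proj₁ (copy-injective X false Y false c)))
  corners-distinct 0F 2F (X , Y , q) c = ⊥-elim (copy-sides X X c)
  corners-distinct 0F 3F (X , Y , q) c = ⊥-elim (copy-sides X (σ⁻¹ X Y) c)
  corners-distinct 1F 0F (X , Y , q) c = ⊥-elim (adj⇒≢ G q (proj₁ (copy-injective X false Y false (sym c))))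
  corners-distinct 1F 1F e c = refl
  corners-distinct 1F 2F (X , Y , q) c = ⊥-elim (copy-sides Y X c)
  corners-distinct 1F 3F (X , Y , q) c = ⊥-elim (copy-sides Y (σ⁻¹ X Y) c)
  corners-distinct 2F 0F (X , Y , q) c = ⊥-elim (copy-sides X X (sym c))
  corners-distinct 2F 1F (X , Y , q) c = ⊥-elim (copy-sides Y X (sym c))
  corners-distinct 2F 2F e c = refl
  corners-distinct 2F 3F (X , Y , q) c = ⊥-elim (adj⇒≢ G (SubsetRotation.prev-preserves (adj G X) q)
    (proj₁ (copy-injective X true (σ⁻¹ X Y) true c)))
  corners-distinct 3F 0F (X , Y , q) c = ⊥-elim (copy-sides X (σ⁻¹ X Y) (sym c))
  corners-distinct 3F 1F (X , Y , q) c = ⊥-elim (copy-sides Y (σ⁻¹ X Y) (sym c))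
  corners-distinct 3F 2F (X , Y , q) c = ⊥-elim (adj⇒≢ G (SubsetRotation.prev-preserves (adj G X) q)
    (proj₁ (copy-injective X true (σ⁻¹ X Y) true (sym c))))
  corners-distinct 3F 3F e c = refl

  tails-apart : ∀ d i j → (∀ t → iterate shift i t ≢ iterate shift j t) →
                tail {H} (iterate φ i d) ≢ tail {H} (iterate φ j d)
  tails-apart d i j apart e = apart (positionOf d) (corners-distinct _ _ (faceOfDart d)
    (trans (sym (cong proj₁ (iterate-φ-faceDart i d))) (trans e (cong proj₁ (iterate-φ-faceDart j d)))))

  φ⁴≡id : ∀ d → iterate φ 4 d ≡ d
  φ⁴≡id d = dart-≡ (trans (iterate-φ-faceDart 4 d)
    (trans (cong (λ t → faceDart t (faceOfDart d)) (iterate-shift-period (positionOf d))) (sym (dart-decomposition d))))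

  -- Walk through G′ to a neighbour Z of proj y, then cross to y.
  connected-interlace : 2 ≤ m → Connected G → Connected H
  connected-interlace 2≤m conn x y with has-neighbour G 2≤m conn (proj m y)
  ... | Z , q = lift (conn (proj m x) Z) x refl (subst T (adj-sym G (proj m y) Z) q)
    where
    lift : ∀ {X Z} → Walk G X Z → ∀ x → proj m x ≡ X → T (adj G Z (proj m y)) → Walk H x y
    lift here             x refl q = step q here
    lift (step {w = W} p w) x refl q =
      step (subst (λ z → T (adj G (proj m x) z)) (sym (proj-copy W false)) p) (lift w (copy W false) (proj-copy W false) q)

numEdges-interlace : ∀ G → numEdges (interlace G) ≡ sum (degree G) + sum (degree G)
numEdges-interlace G = *-cancelˡ-≡ _ _ 2 (begin
  2 * numEdges (interlace G)                                  ≡⟨ sym (handshake (interlace G)) ⟩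
  ∑[ x < m + m ] ∑[ y < m + m ] ⌊ adj G (proj m x) (proj m y) ⌋ ≡⟨ sum-cong-≗ (λ x → sum-proj m (adj-count (proj m x))) ⟩
  ∑[ x < m + m ] (degree G (proj m x) + degree G (proj m x))  ≡⟨ ∑-distrib-+ (degree G ∘ proj m) (degree G ∘ proj m) ⟩
  ∑[ x < m + m ] degree G (proj m x) + ∑[ x < m + m ] degree G (proj m x) ≡⟨ cong₂ _+_ (sum-proj m (degree G)) (sum-proj m (degree G)) ⟩
  (D + D) + (D + D)                                           ≡⟨ cong ((D + D) +_) (sym (+-identityʳ (D + D))) ⟩
  2 * (D + D)                                                 ∎)
  where
  open ≡-Reasoning
  m : ℕ
  m = ∣V∣ G
  D : ℕ
  D = sum (degree G)
  adj-count : Fin m → Fin m → ℕ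
  adj-count u v = ⌊ adj G u v ⌋

euler-interlace : ∀ G g → HasBetti G g → ∣V∣ G + ∣V∣ G + sum (degree G) + 2 * g ≡ 2 + numEdges (interlace G)
euler-interlace G g betti = begin
  m + m + D + 2 * g              ≡⟨ cong (λ x → m + m + x + 2 * g) (handshake G) ⟩
  m + m + 2 * E + 2 * g          ≡⟨ regroup m g E ⟩
  2 * (m + g) + 2 * E            ≡⟨ cong (λ x → 2 * x + 2 * E) (sym betti) ⟩
  2 * (E + 1) + 2 * E            ≡⟨ expand E ⟩
  2 + (2 * E + 2 * E)            ≡⟨ cong (λ x → 2 + (x + x)) (sym (handshake G)) ⟩
  2 + (D + D)                    ≡⟨ cong (2 +_) (sym (numEdges-interlace G)) ⟩
  2 + numEdges (interlace G)     ∎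
  where
  open ≡-Reasoning
  open +-*-Solver
  m : ℕ
  m = ∣V∣ G
  D : ℕ
  D = sum (degree G)
  E : ℕ
  E = numEdges G
  regroup : ∀ m g E → m + m + 2 * E + 2 * g ≡ 2 * (m + g) + 2 * E
  regroup = solve 3 (λ m g E → m :+ m :+ con 2 :* E :+ con 2 :* g := con 2 :* (m :+ g) :+ con 2 :* E) refl
  expand : ∀ E → 2 * (E + 1) + 2 * E ≡ 2 + (2 * E + 2 * E)
  expand = solve 1 (λ E → con 2 :* (E :+ con 1) :+ con 2 :* E := con 2 :+ (con 2 :* E :+ con 2 :* E)) refl

spinal-quadrangulation : ∀ G g → 2 ≤ ∣V∣ G → Connected G → HasBetti G g →
                         Σ (Embedding (interlace G) g) IsQuadrangulation
spinal-quadrangulation G g 2≤m conn betti = embedding , quadrangles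
  where
  open Spinal G
  embedding : Embedding H g
  embedding = record
    { connected     = connected-interlace 2≤m conn
    ; rotation      = rotation
    ; numFaces      = sum (degree G)
    ; face          = face
    ; face-surj     = face-surj
    ; face-sound    = face-sound
    ; face-complete = face-complete
    ; euler         = euler-interlace G g betti
    }
  quadrangles : IsQuadrangulation embedding
  quadrangles d = φ⁴≡id d
    , tails-apart d 0 1 (λ { 0F () ; 1F () ; 2F () ; 3F () })
    , tails-apart d 0 2 (λ { 0F () ; 1F () ; 2F () ; 3F () })
    , tails-apart d 0 3 (λ { 0F () ; 1F () ; 2F () ; 3F () })
    , tails-apart d 1 2 (λ { 0F () ; 1F () ; 2F () ; 3F () })
    , tails-apart d 1 3 (λ { 0F () ; 1F () ; 2F () ; 3F () })
    , tails-apart d 2 3 (λ { 0F () ; 1F () ; 2F () ; 3F () })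

interlace-chromatic : ∀ G k → HasChromaticNumber G k → HasChromaticNumber (interlace G) k
interlace-chromatic G k ((c , proper) , minimal) =
  (c ∘ proj (∣V∣ G) , λ x y → proper (proj (∣V∣ G) x) (proj (∣V∣ G) y)) ,
  λ j j<k (c′ , proper′) → minimal j j<k (c′ ∘ (λ v → copy v false) ,
    λ u v q → proper′ (copy u false) (copy v false) (subst T (sym (adj-copy u false v false)) q))
  where open Spinal G

extendAdj : ∀ {m} → (Fin m → Fin m → Bool) → (Fin m → Bool) → Fin (suc m) → Fin (suc m) → Bool
extendAdj A S Fin.zero    Fin.zero    = false
extendAdj A S Fin.zero    (Fin.suc j) = S j
extendAdj A S (Fin.suc i) Fin.zero    = S i
extendAdj A S (Fin.suc i) (Fin.suc j) = A i j

extendAdj-sym : ∀ {m} {A : Fin m → Fin m → Bool} S → (∀ i j → A i j ≡ A j i) →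
                ∀ i j → extendAdj A S i j ≡ extendAdj A S j i
extendAdj-sym S sym-A Fin.zero    Fin.zero    = refl
extendAdj-sym S sym-A Fin.zero    (Fin.suc j) = refl
extendAdj-sym S sym-A (Fin.suc i) Fin.zero    = refl
extendAdj-sym S sym-A (Fin.suc i) (Fin.suc j) = sym-A i j

extendAdj-irrefl : ∀ {m} {A : Fin m → Fin m → Bool} S → (∀ i → A i i ≡ false) →
                   ∀ i → extendAdj A S i i ≡ false
extendAdj-irrefl S irr-A Fin.zero    = refl
extendAdj-irrefl S irr-A (Fin.suc i) = irr-A i

infixl 5 _⊕_
_⊕_ : (G : Graph) → (Fin (∣V∣ G) → Bool) → Graph
G ⊕ S = record
  { ∣V∣    = suc (∣V∣ G)
  ; adj    = extendAdj (adj G) S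
  ; sym    = extendAdj-sym S (adj-sym G)
  ; irrefl = extendAdj-irrefl S (irrefl G)
  }

numEdges-⊕ : ∀ G S → numEdges (G ⊕ S) ≡ count S + numEdges G
numEdges-⊕ G S = trans (numEdges-∑ (G ⊕ S)) (cong₂ _+_
  (sum-cong-≗ (λ j → cong ⌊_⌋ (∧-identityʳ (S j))))
  (trans (sum-cong-≗ (λ i → cong (_+ row i) (cong ⌊_⌋ (∧-zeroʳ (S i))))) (sym (numEdges-∑ G))))
  where
  row : Fin (∣V∣ G) → ℕ
  row i = ∑[ j < ∣V∣ G ] ⌊ adj G i j ∧ (toℕ i <ᵇ toℕ j) ⌋

betti-⊕ : ∀ G S {b c} → HasBetti G b → count S ≡ suc c → HasBetti (G ⊕ S) (c + b)
betti-⊕ G S {b} {c} betti |S|≡1+c = begin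
  numEdges (G ⊕ S) + 1    ≡⟨ cong (_+ 1) (numEdges-⊕ G S) ⟩
  count S + numEdges G + 1 ≡⟨ cong (λ x → x + numEdges G + 1) |S|≡1+c ⟩
  suc c + numEdges G + 1   ≡⟨ shuffle c (numEdges G) ⟩
  suc (c + (numEdges G + 1)) ≡⟨ cong (λ x → suc (c + x)) betti ⟩
  suc (c + (∣V∣ G + b))   ≡⟨ cong suc (swap c (∣V∣ G) b) ⟩
  suc (∣V∣ G) + (c + b)   ∎
  where
  open ≡-Reasoning
  open +-*-Solver
  shuffle : ∀ c E → suc c + E + 1 ≡ suc (c + (E + 1))
  shuffle = solve 2 (λ c E → con 1 :+ c :+ E :+ con 1 := con 1 :+ (c :+ (E :+ con 1))) refl
  swap : ∀ c m b → c + (m + b) ≡ m + (c + b)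
  swap = solve 3 (λ c m b → c :+ (m :+ b) := m :+ (c :+ b)) refl

connected-⊕ : ∀ G S → Connected G → ∃ (T ∘ S) → Connected (G ⊕ S)
connected-⊕ G S conn (i , Si) = walk
  where
  lift : ∀ {u v} → Walk G u v → Walk (G ⊕ S) (Fin.suc u) (Fin.suc v)
  lift here       = here
  lift (step q w) = step q (lift w)
  return : ∀ {u} → Walk (G ⊕ S) u (Fin.suc i) → Walk (G ⊕ S) u Fin.zero
  return here       = step Si here
  return (step q w) = step q (return w)
  walk : Connected (G ⊕ S)
  walk Fin.zero    Fin.zero    = here
  walk Fin.zero    (Fin.suc v) = step Si (lift (conn i v))
  walk (Fin.suc u) Fin.zero    = return (lift (conn u i))
  walk (Fin.suc u) (Fin.suc v) = lift (conn u v)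

Proper : ∀ {k} (G : Graph) → (Fin (∣V∣ G) → Fin k) → Set
Proper G c = ∀ u v → T (adj G u v) → c u ≢ c v

proper-⊕ : ∀ {k} G S {c : Fin (∣V∣ G) → Fin k} {κ} → Proper G c → (∀ i → T (S i) → κ ≢ c i) →
           Proper (G ⊕ S) (κ ∷ c)
proper-⊕ G S proper fresh Fin.zero    Fin.zero    ()
proper-⊕ G S proper fresh Fin.zero    (Fin.suc v) q = fresh v q
proper-⊕ G S proper fresh (Fin.suc u) Fin.zero    q = fresh u q ∘ sym
proper-⊕ G S proper fresh (Fin.suc u) (Fin.suc v) q = proper u v q

not-colourable-⊕ : ∀ G S {j} → ¬ Colourable G j → ¬ Colourable (G ⊕ S) j
not-colourable-⊕ G S ¬col (c , proper) = ¬col (c ∘ Fin.suc , λ u v → proper (Fin.suc u) (Fin.suc v))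

completeAdj : ∀ n → Fin n → Fin n → Bool
completeAdj zero    ()
completeAdj (suc n) = extendAdj (completeAdj n) (λ _ → true)

completeAdj-sym : ∀ n i j → completeAdj n i j ≡ completeAdj n j i
completeAdj-sym zero    ()
completeAdj-sym (suc n) = extendAdj-sym _ (completeAdj-sym n)

completeAdj-irrefl : ∀ n i → completeAdj n i i ≡ false
completeAdj-irrefl zero    ()
completeAdj-irrefl (suc n) = extendAdj-irrefl _ (completeAdj-irrefl n)

-- Not defined by recursion through _⊕_, so that ∣V∣ (complete n) reduces to n;
-- complete (suc n) still unfolds to complete n ⊕ λ _ → true.
complete : ℕ → Graph
complete n = record
  { ∣V∣ = n ; adj = completeAdj n ; sym = completeAdj-sym n ; irrefl = completeAdj-irrefl n }

completeAdj-≢ : ∀ n {i j} → i ≢ j → T (completeAdj n i j)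
completeAdj-≢ (suc n) {Fin.zero}  {Fin.zero}  i≢j = i≢j refl
completeAdj-≢ (suc n) {Fin.zero}  {Fin.suc j} i≢j = _
completeAdj-≢ (suc n) {Fin.suc i} {Fin.zero}  i≢j = _
completeAdj-≢ (suc n) {Fin.suc i} {Fin.suc j} i≢j = completeAdj-≢ n (i≢j ∘ cong Fin.suc)

complete-not-colourable : ∀ n j → j < n → ¬ Colourable (complete n) j
complete-not-colourable n j j<n (c , proper) with pigeonhole j<n c
... | u , v , u<v , cu≡cv = proper u v (completeAdj-≢ n (<⇒≢ u<v)) cu≡cv

id-proper : ∀ G → Proper G (λ v → v)
id-proper G u v q = adj⇒≢ G q

-- triangle n = 0 + 1 + ⋯ + (n - 1) = β(K_{n+1}).
triangle : ℕ → ℕ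
triangle zero    = 0
triangle (suc n) = n + triangle n

double-triangle : ∀ n → 2 * triangle (suc n) ≡ suc n * n
double-triangle zero    = refl
double-triangle (suc n) = begin
  2 * (suc n + triangle (suc n))        ≡⟨ *-distribˡ-+ 2 (suc n) (triangle (suc n)) ⟩
  2 * suc n + 2 * triangle (suc n)      ≡⟨ cong (2 * suc n +_) (double-triangle n) ⟩
  2 * suc n + suc n * n                 ≡⟨ solve 1 (λ n → con 2 :* (con 1 :+ n) :+ (con 1 :+ n) :* n
                                                       := (con 2 :+ n) :* (con 1 :+ n)) refl n ⟩
  suc (suc n) * suc n                   ∎
  where
  open ≡-Reasoning
  open +-*-Solver

count-true : ∀ m → count (λ (_ : Fin m) → true) ≡ m
count-true zero    = refl
count-true (suc m) = cong suc (count-true m)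

betti-complete : ∀ n → HasBetti (complete (suc n)) (triangle n)
betti-complete zero    = refl
betti-complete (suc n) = betti-⊕ (complete (suc n)) (λ _ → true) (betti-complete n) (count-true (suc n))

connected-complete : ∀ n → Connected (complete (suc n))
connected-complete zero    Fin.zero Fin.zero = here
connected-complete (suc n) = connected-⊕ (complete (suc n)) (λ _ → true) (connected-complete n) (Fin.zero , _)

isZero : ∀ {m} → Fin m → Bool
isZero Fin.zero    = true
isZero (Fin.suc _) = false

count-isZero : ∀ m → count (isZero {suc m}) ≡ 1
count-isZero m = cong suc (sum-replicate-zero m)

twins : (G : Graph) → Fin (∣V∣ G) → ℕ → Graph
twins G v zero    = G
twins G v (suc k) = twins (G ⊕ adj G v) (Fin.suc v) k

twins-size : ∀ G v k → 2 ≤ ∣V∣ G → 2 ≤ ∣V∣ (twins G v k)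
twins-size G v zero    2≤m = 2≤m
twins-size G v (suc k) 2≤m = twins-size (G ⊕ adj G v) (Fin.suc v) k (m≤n⇒m≤1+n 2≤m)

twins-connected : ∀ G v k → Connected G → ∃ (T ∘ adj G v) → Connected (twins G v k)
twins-connected G v zero    conn _           = conn
twins-connected G v (suc k) conn (u , v~u) =
  twins-connected (G ⊕ adj G v) (Fin.suc v) k (connected-⊕ G (adj G v) conn (u , v~u)) (Fin.suc u , v~u)

twins-betti : ∀ G v k {b} → degree G v ≡ 2 → HasBetti G b → HasBetti (twins G v k) (k + b)
twins-betti G v zero    deg betti = betti
twins-betti G v (suc k) {b} deg betti = subst (HasBetti (twins G v (suc k))) (+-suc k b)
  (twins-betti (G ⊕ adj G v) (Fin.suc v) k twin-degree (betti-⊕ G (adj G v) betti deg))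
  where
  twin-degree : degree (G ⊕ adj G v) (Fin.suc v) ≡ 2
  twin-degree rewrite irrefl G v = deg

twins-colourable : ∀ G v k {j} → Colourable G j → Colourable (twins G v k) j
twins-colourable G v zero    col          = col
twins-colourable G v (suc k) (c , proper) = twins-colourable (G ⊕ adj G v) (Fin.suc v) k
  (c v ∷ c , proper-⊕ G (adj G v) proper (proper v))

twins-not-colourable : ∀ G v k {j} → ¬ Colourable G j → ¬ Colourable (twins G v k) j
twins-not-colourable G v zero    ¬col = ¬col
twins-not-colourable G v (suc k) ¬col =
  twins-not-colourable (G ⊕ adj G v) (Fin.suc v) k (not-colourable-⊕ G (adj G v) ¬col)

completeWithPendant : ℕ → Graph
completeWithPendant n = complete (2 + n) ⊕ isZero

-- K_{n+2} with a path K₀ — p — q hung at its vertex 0; p has index 1 and degree 2.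
completeWithPath : ℕ → Graph
completeWithPath n = completeWithPendant n ⊕ isZero

spine : ℕ → ℕ → Graph
spine n k = twins (completeWithPath n) 1F k

spine-size : ∀ n k → 2 ≤ ∣V∣ (spine n k)
spine-size n k = twins-size (completeWithPath n) 1F k (s≤s (s≤s z≤n))

spine-connected : ∀ n k → Connected (spine n k)
spine-connected n k = twins-connected (completeWithPath n) 1F k
  (connected-⊕ (completeWithPendant n) isZero (connected-⊕ (complete (2 + n)) isZero (connected-complete (suc n)) (0F , _)) (0F , _))
  (0F , _)

spine-betti : ∀ n k → HasBetti (spine n k) (k + triangle (suc n))
spine-betti n k = twins-betti (completeWithPath n) 1F k (cong suc (count-isZero (suc n)))
  (betti-⊕ (completeWithPendant n) isZero (betti-⊕ (complete (2 + n)) isZero (betti-complete (suc n)) (count-isZero (suc n)))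
    (count-isZero (2 + n)))

spine-chromatic : ∀ n k → HasChromaticNumber (spine n k) (2 + n)
spine-chromatic n k =
  twins-colourable (completeWithPath n) 1F k (0F ∷ 1F ∷ (λ v → v) ,
    proper-⊕ (completeWithPendant n) isZero (proper-⊕ (complete (2 + n)) isZero (id-proper (complete (2 + n)))
      (λ { 0F _ () })) (λ { 0F _ () })) ,
  λ j j<n → twins-not-colourable (completeWithPath n) 1F k
    (not-colourable-⊕ (completeWithPendant n) isZero (not-colourable-⊕ (complete (2 + n)) isZero (complete-not-colourable (2 + n) j j<n)))

corollary1 : ∀ (g n : ℕ) → 2 ≤ n → (n ∸ 1) * (n ∸ 2) ≤ 2 * g → SpinalQuadrangulationWithχ g n
corollary1 g (suc (suc n)) (s≤s (s≤s z≤n)) bound =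
  spine n k , spine-size n k , spine-connected n k , betti ,
  spinal-quadrangulation (spine n k) g (spine-size n k) (spine-connected n k) betti ,
  interlace-chromatic (spine n k) (2 + n) (spine-chromatic n k)
  where
  β₀ : ℕ
  β₀ = triangle (suc n)
  β₀≤g : β₀ ≤ g
  β₀≤g = *-cancelˡ-≤ 2 (subst (_≤ 2 * g) (sym (double-triangle n)) bound)
  k : ℕ
  k = g ∸ β₀
  betti : HasBetti (spine n k) g
  betti = subst (HasBetti (spine n k)) (m∸n+n≡m β₀≤g) (spine-betti n k)
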